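{- Let $1\leq x,n<\omega$, and let $X=(x_1,\ldots,x_{2^n})$ with $x_i=x+2(i-1)$ for $i\in\{1,\ldots,2^n\}$. Then each element of $(x_1,\ldots,x_{2^{n-1}})$ dominates exactly $2^{n-1}$ elements of $X$ and is dominated by exactly $2^{n-1}-1$ elements of $X$, and each element of $(x_{2^{n-1}+1},\ldots,x_{2^n})$ dominates exactly $2^{n-1}-1$ elements of $X$ and is dominated by exactly $2^{n-1}$ elements of $X$.
   Context: For a nonzero integer $z$, $\mathsf{odd}(z)$ is $z$ divided by the largest power of $2$ dividing it. For distinct integers $a,b$, $a$ dominates $b$ iff $\mathsf{odd}(b-a)\equiv 1\pmod 4$. -}

module Defs where

open import Data.Nat as ℕ using (ℕ; zero; suc)
open import Data.Nat.DivMod using (_/_; _%_)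
open import Data.Integer as ℤ using (ℤ; +_; _-_; ∣_∣; sign; _◃_)
open import Data.Integer.Divisibility.Signed using (_∣_; _∣?_)
open import Data.List using (List; length; filter; map; upTo)
open import Data.Product using (_×_)
open import Relation.Binary.PropositionalEquality using (_≡_)
open import Relation.Nullary using (¬_; Dec)
open import Relation.Nullary.Decidable using (_×-dec_; ¬?)
import Data.Integer.Properties as ℤP

-- Odd part of a natural number: divide out all factors of 2.
-- (Fuel-based; fuel m ≥ the number suffices, since each step halves.)
oddPartℕ-fuel : ℕ → ℕ → ℕ
oddPartℕ-fuel zero    m = m
oddPartℕ-fuel (suc k) zero = zero
oddPartℕ-fuel (suc k) (suc m) with suc m % 2
... | zero  = oddPartℕ-fuel k (suc m / 2)
... | suc _ = suc m

oddPartℕ : ℕ → ℕ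
oddPartℕ m = oddPartℕ-fuel m m

odd : ℤ → ℤ
odd z = sign z ◃ oddPartℕ ∣ z ∣

Dominates : ℤ → ℤ → Set
Dominates a b = (¬ a ≡ b) × ((+ 4) ∣ (odd (b - a) - + 1))

dominates? : (a b : ℤ) → Dec (Dominates a b)
dominates? a b = ¬? (a ℤ.≟ b) ×-dec (+ 4 ∣? (odd (b - a) - + 1))

seqX : ℕ → ℕ → ℤ
seqX x i = + x ℤ.+ + (2 ℕ.* (i ℕ.∸ 1))

indices : ℕ → List ℕ
indices N = map suc (upTo N)

outdeg : ℕ → ℕ → ℕ → ℕ
outdeg x n i = length (filter (λ j → dominates? (seqX x i) (seqX x j)) (indices (2 ℕ.^ n)))

indeg : ℕ → ℕ → ℕ → ℕ
indeg x n i = length (filter (λ j → dominates? (seqX x j) (seqX x i)) (indices (2 ℕ.^ n)))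

-- The elements of X are x + 2(i - 1), so differences are twice differences of indices, and
-- odd(2d) = odd(d). Writing p(d) for "odd(d) ≡ 1 (mod 4)", x_{a+1} dominates x_{a+1+d} iff p(d),
-- and x_{a+1+d} dominates x_{a+1} iff ¬ p(d) (as odd(-d) = -odd(d) and odd(d) is odd). With
-- a + 1 + A = 2^n, the outdegree of x_{a+1} is #{d ≤ A : p d} + #{d ≤ a : ¬ p d}, the indegree
-- the same with a and A exchanged. For h = 2^(n-1), p is antisymmetric about h: p(2h - d) = ¬ p(d)
-- for d ≠ h (for odd d since 2h - d ≡ -d (mod 4), for even d by halving), while p(h) holds. So
-- moving the split point a one step to the right keeps the count unless a + 1 = h, where it drops
-- by one. Comparing the two extreme splits, #{d < 2h : p d} exceeds #{d < 2h : ¬ p d} by one, and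
-- the two add up to 2h - 1; hence the first count is h.

module Submission where

open import Defs
open import Data.Nat using (ℕ; _≤_; _^_; _∸_; _+_)
open import Data.Product using (_×_)
open import Relation.Binary.PropositionalEquality using (_≡_)

open import Data.Bool using (Bool; true; false; not; _xor_)
open import Data.Bool.Properties using (not-involutive; not-distribˡ-xor; xor-same)
open import Data.Integer as ℤ using (ℤ; +_; -_; _-_; 0ℤ)
import Data.Integer.Properties as ℤ
open import Data.Integer.Divisibility.Signed using (_∣?_)
open import Data.List using (length; filter; applyUpTo)
open import Data.List.Properties using (map-upTo)
open import Data.Nat as ℕ using (zero; suc; pred; _*_; _<_; s≤s; z≤n)
open import Data.Nat.DivMod using (_/_; _%_; m≡m%n+[m/n]*n; m%n<n; m/n<m; m*n/n≡m; m*n%n≡0; [m+kn]%n≡m%n)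
import Data.Nat.Divisibility as ℕ
open import Data.Nat.Properties
open import Data.Nat.Tactic.RingSolver using (solve-∀)
open import Data.Product using (_,_; ∃-syntax)
open import Function using (_∘′_; mk⇔)
open import Relation.Nullary using (does; yes; no; contradiction)
open import Relation.Nullary.Decidable using (does-⇔; dec-true; dec-false)
open import Relation.Unary using (Pred; Decidable)
open import Relation.Binary.PropositionalEquality
  using (_≢_; refl; sym; trans; cong; cong₂; subst; module ≡-Reasoning)

oddPartℕ-fuel-zero : ∀ k → oddPartℕ-fuel k 0 ≡ 0
oddPartℕ-fuel-zero zero    = refl
oddPartℕ-fuel-zero (suc k) = refl

oddPartℕ-fuel-even : ∀ k m → suc m % 2 ≡ 0 →
  oddPartℕ-fuel (suc k) (suc m) ≡ oddPartℕ-fuel k (suc m / 2)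
oddPartℕ-fuel-even k m eq with suc m % 2
... | zero  = refl
... | suc _ = contradiction eq λ ()

oddPartℕ-fuel-odd : ∀ k m → suc m % 2 ≡ 1 → oddPartℕ-fuel (suc k) (suc m) ≡ suc m
oddPartℕ-fuel-odd k m eq with suc m % 2
... | zero  = contradiction eq λ ()
... | suc _ = refl

half<self : ∀ m → suc m / 2 < suc m
half<self m = m/n<m (suc m) 2 (s≤s (s≤s z≤n))

oddPartℕ-fuel-stable : ∀ {k k' m} → m ≤ k → m ≤ k' → oddPartℕ-fuel k m ≡ oddPartℕ-fuel k' m
oddPartℕ-fuel-stable {k} {k'} {zero} _ _ = trans (oddPartℕ-fuel-zero k) (sym (oddPartℕ-fuel-zero k'))
oddPartℕ-fuel-stable {suc k} {suc k'} {suc m} (s≤s m≤k) (s≤s m≤k') with suc m % 2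
... | zero  = oddPartℕ-fuel-stable (≤-trans half≤m m≤k) (≤-trans half≤m m≤k')
  where
  half≤m : suc m / 2 ≤ m
  half≤m = ≤-pred (half<self m)
... | suc _ = refl

oddPartℕ-fuel-odd-valued : ∀ k m → m < k → ∃[ t ] oddPartℕ-fuel k (suc m) ≡ suc (2 * t)
oddPartℕ-fuel-odd-valued (suc k) m (s≤s m≤k) with suc m % 2 in parity
... | zero with suc m / 2 | m≡m%n+[m/n]*n (suc m) 2 | half<self m
...   | zero    | split | _         = contradiction (trans split (cong (_+ 0) parity)) λ ()
...   | suc m'  | _     | s≤s m'<m  = oddPartℕ-fuel-odd-valued k m' (≤-trans m'<m m≤k)
oddPartℕ-fuel-odd-valued (suc k) m _ | suc zero =
  suc m / 2 , trans (m≡m%n+[m/n]*n (suc m) 2) (cong₂ _+_ parity (*-comm (suc m / 2) 2))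
oddPartℕ-fuel-odd-valued (suc k) m _ | suc (suc r) =
  contradiction (subst (_< 2) parity (m%n<n (suc m) 2)) λ { (s≤s (s≤s ())) }

oddPartℕ-double : ∀ m → oddPartℕ (2 * m) ≡ oddPartℕ m
oddPartℕ-double zero    = refl
oddPartℕ-double (suc m) = begin
  oddPartℕ-fuel (suc n) (2 * suc m)   ≡⟨ oddPartℕ-fuel-even n n even ⟩
  oddPartℕ-fuel n (2 * suc m / 2)     ≡⟨ cong (oddPartℕ-fuel n) half ⟩
  oddPartℕ-fuel n (suc m)             ≡⟨ oddPartℕ-fuel-stable (≤-pred (subst (_< suc n) half (half<self n))) ≤-refl ⟩
  oddPartℕ (suc m)                    ∎
  where
  open ≡-Reasoning
  n : ℕ
  n = pred (2 * suc m)
  even : 2 * suc m % 2 ≡ 0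
  even = trans (cong (_% 2) (*-comm 2 (suc m))) (m*n%n≡0 (suc m) 2)
  half : 2 * suc m / 2 ≡ suc m
  half = trans (cong (_/ 2) (*-comm 2 (suc m))) (m*n/n≡m (suc m) 2)

oddPartℕ-odd : ∀ t → oddPartℕ (suc (2 * t)) ≡ suc (2 * t)
oddPartℕ-odd t = oddPartℕ-fuel-odd (2 * t) (2 * t)
  (trans (cong (λ k → suc k % 2) (*-comm 2 t)) ([m+kn]%n≡m%n 1 t 2))

oddPartℕ-odd-valued : ∀ m → ∃[ t ] oddPartℕ (suc m) ≡ suc (2 * t)
oddPartℕ-odd-valued m = oddPartℕ-fuel-odd-valued (suc m) m ≤-refl

isOdd : ℕ → Bool
isOdd zero    = false
isOdd (suc n) = not (isOdd n)

isOdd-+ : ∀ m n → isOdd (m + n) ≡ isOdd m xor isOdd n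
isOdd-+ zero    n = refl
isOdd-+ (suc m) n = trans (cong not (isOdd-+ m n)) (not-distribˡ-xor (isOdd m) (isOdd n))

isOdd-2* : ∀ n → isOdd (2 * n) ≡ false
isOdd-2* n = begin
  isOdd (n + (n + 0))         ≡⟨ isOdd-+ n (n + 0) ⟩
  isOdd n xor isOdd (n + 0)   ≡⟨ cong (λ k → isOdd n xor isOdd k) (+-identityʳ n) ⟩
  isOdd n xor isOdd n         ≡⟨ xor-same (isOdd n) ⟩
  false                       ∎
  where open ≡-Reasoning

does-4∣?-4+ : ∀ n → does (4 ℕ.∣? (4 + n)) ≡ does (4 ℕ.∣? n)
does-4∣?-4+ n = does-⇔ (mk⇔ (λ 4∣4+n → ℕ.∣m+n∣m⇒∣n 4∣4+n ℕ.∣-refl) (ℕ.∣m∣n⇒∣m+n ℕ.∣-refl))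
  (4 ℕ.∣? (4 + n)) (4 ℕ.∣? n)

does-4∣?-2* : ∀ t → does (4 ℕ.∣? (2 * t)) ≡ not (isOdd t)
does-4∣?-2* zero          = refl
does-4∣?-2* (suc zero)    = refl
does-4∣?-2* (suc (suc t)) = begin
  does (4 ℕ.∣? (2 * suc (suc t)))  ≡⟨ cong (λ k → does (4 ℕ.∣? k)) (trans (*-suc 2 (suc t)) (cong (λ k → 2 + k) (*-suc 2 t))) ⟩
  does (4 ℕ.∣? (4 + 2 * t))        ≡⟨ does-4∣?-4+ (2 * t) ⟩
  does (4 ℕ.∣? (2 * t))            ≡⟨ does-4∣?-2* t ⟩
  not (isOdd t)                    ≡⟨ cong not (sym (not-involutive (isOdd t))) ⟩
  not (isOdd (suc (suc t)))        ∎
  where open ≡-Reasoning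

oneMod4 : ℤ → Bool
oneMod4 z = does (+ 4 ∣? (z - + 1))

oneMod4-odd : ∀ t → oneMod4 (+ suc (2 * t)) ≡ not (isOdd t)
oneMod4-odd = does-4∣?-2*

oneMod4-neg-odd : ∀ t → oneMod4 (- + suc (2 * t)) ≡ isOdd t
oneMod4-neg-odd t = begin
  does (4 ℕ.∣? suc (suc (2 * t + 0)))  ≡⟨ cong (λ k → does (4 ℕ.∣? suc (suc k))) (+-identityʳ (2 * t)) ⟩
  does (4 ℕ.∣? (2 + 2 * t))            ≡⟨ cong (λ k → does (4 ℕ.∣? k)) (sym (*-suc 2 t)) ⟩
  does (4 ℕ.∣? (2 * suc t))            ≡⟨ does-4∣?-2* (suc t) ⟩
  not (not (isOdd t))                  ≡⟨ not-involutive (isOdd t) ⟩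
  isOdd t                              ∎
  where open ≡-Reasoning

oddPartIsOneMod4 : ℕ → Bool
oddPartIsOneMod4 k = oneMod4 (+ oddPartℕ k)

oddPartIsOneMod4-odd : ∀ t → oddPartIsOneMod4 (suc (2 * t)) ≡ not (isOdd t)
oddPartIsOneMod4-odd t = trans (cong (oneMod4 ∘′ +_) (oddPartℕ-odd t)) (oneMod4-odd t)

oddPartIsOneMod4-double : ∀ m → oddPartIsOneMod4 (2 * m) ≡ oddPartIsOneMod4 m
oddPartIsOneMod4-double m = cong (oneMod4 ∘′ +_) (oddPartℕ-double m)

oddPartIsOneMod4-2^ : ∀ m → oddPartIsOneMod4 (2 ^ m) ≡ true
oddPartIsOneMod4-2^ zero    = refl
oddPartIsOneMod4-2^ (suc m) = trans (oddPartIsOneMod4-double (2 ^ m)) (oddPartIsOneMod4-2^ m)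

oneMod4-neg-oddPart : ∀ m → oneMod4 (- + oddPartℕ (suc m)) ≡ not (oddPartIsOneMod4 (suc m))
oneMod4-neg-oddPart m with oddPartℕ-odd-valued m
... | t , odd-part rewrite odd-part =
  trans (oneMod4-neg-odd t) (sym (trans (cong not (oneMod4-odd t)) (not-involutive (isOdd t))))

data EvenOdd : ℕ → Set where
  2*_   : ∀ t → EvenOdd (2 * t)
  1+2*_ : ∀ t → EvenOdd (suc (2 * t))

evenOdd : ∀ n → EvenOdd n
evenOdd zero = 2* 0
evenOdd (suc n) with evenOdd n
... | 2* t   = 1+2* t
... | 1+2* t = subst EvenOdd (*-suc 2 t) (2* suc t)

-- Also valid when k or k' is 0 (odd part 0, not ≡ 1 mod 4), so no positivity hypothesis is needed.
oddPartIsOneMod4-reflect : ∀ m k k' → k + k' ≡ 2 ^ suc m → k ≢ 2 ^ m →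
  oddPartIsOneMod4 k' ≡ not (oddPartIsOneMod4 k)
oddPartIsOneMod4-reflect zero 0 _ refl _   = refl
oddPartIsOneMod4-reflect zero 1 _ refl k≢1 = contradiction refl k≢1
oddPartIsOneMod4-reflect zero 2 _ refl _   = refl
oddPartIsOneMod4-reflect zero (suc (suc (suc _))) _ () _
oddPartIsOneMod4-reflect (suc m) k k' sum k≢ with evenOdd k | evenOdd k'
... | 2* t | 2* t' = begin
  oddPartIsOneMod4 (2 * t')    ≡⟨ oddPartIsOneMod4-double t' ⟩
  oddPartIsOneMod4 t'          ≡⟨ oddPartIsOneMod4-reflect m t t' halves (k≢ ∘′ cong (2 *_)) ⟩
  not (oddPartIsOneMod4 t)     ≡⟨ cong not (sym (oddPartIsOneMod4-double t)) ⟩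
  not (oddPartIsOneMod4 (2 * t)) ∎
  where
  open ≡-Reasoning
  halves : t + t' ≡ 2 ^ suc m
  halves = *-cancelˡ-≡ (t + t') (2 ^ suc m) 2 (trans (*-distribˡ-+ 2 t t') sum)
... | 1+2* t | 1+2* t' = begin
  oddPartIsOneMod4 (suc (2 * t'))  ≡⟨ oddPartIsOneMod4-odd t' ⟩
  not (isOdd t')                   ≡⟨ sym (xor≡false⇒≡ (isOdd t) (not (isOdd t')) opposite) ⟩
  isOdd t                          ≡⟨ sym (not-involutive (isOdd t)) ⟩
  not (not (isOdd t))              ≡⟨ cong not (sym (oddPartIsOneMod4-odd t)) ⟩
  not (oddPartIsOneMod4 (suc (2 * t))) ∎
  where
  open ≡-Reasoning
  xor≡false⇒≡ : ∀ x y → x xor y ≡ false → x ≡ y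
  xor≡false⇒≡ false false _ = refl
  xor≡false⇒≡ true  true  _ = refl
  odd+odd : ∀ t t' → 2 * (t + suc t') ≡ suc (2 * t) + suc (2 * t')
  odd+odd = solve-∀
  sum/2 : t + suc t' ≡ 2 * 2 ^ m
  sum/2 = *-cancelˡ-≡ (t + suc t') (2 * 2 ^ m) 2 (trans (odd+odd t t') sum)
  opposite : isOdd t xor not (isOdd t') ≡ false
  opposite = trans (sym (isOdd-+ t (suc t'))) (trans (cong isOdd sum/2) (isOdd-2* (2 ^ m)))
... | 2* t | 1+2* t' = contradiction
  (trans (sym sum) (trans (+-suc (2 * t) (2 * t')) (cong suc (sym (*-distribˡ-+ 2 t t')))))
  (even≢odd (2 ^ suc m) (t + t'))
... | 1+2* t | 2* t' = contradiction
  (trans (sym sum) (cong suc (sym (*-distribˡ-+ 2 t t'))))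
  (even≢odd (2 ^ suc m) (t + t'))

toℕ : Bool → ℕ
toℕ false = 0
toℕ true  = 1

count : (ℕ → Bool) → ℕ → ℕ
count f zero    = 0
count f (suc n) = toℕ (f 0) + count (f ∘′ suc) n

count-cong : ∀ {f g} → (∀ k → f k ≡ g k) → ∀ n → count f n ≡ count g n
count-cong f≗g zero    = refl
count-cong f≗g (suc n) = cong₂ _+_ (cong toℕ (f≗g 0)) (count-cong (λ k → f≗g (suc k)) n)

count-+ : ∀ f m n → count f (m + n) ≡ count f m + count (λ k → f (m + k)) n
count-+ f zero    n = refl
count-+ f (suc m) n = trans (cong (λ c → toℕ (f 0) + c) (count-+ (f ∘′ suc) m n)) (sym (+-assoc (toℕ (f 0)) _ _))

count-suc : ∀ f n → count f (suc n) ≡ count f n + toℕ (f n)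
count-suc f zero    = +-comm (toℕ (f 0)) 0
count-suc f (suc n) = trans (cong (λ c → toℕ (f 0) + c) (count-suc (f ∘′ suc) n)) (sym (+-assoc (toℕ (f 0)) _ _))

count-reverse : ∀ f g a → (∀ b d → b + suc d ≡ a → f b ≡ g (suc d)) → count f a ≡ count (g ∘′ suc) a
count-reverse f g zero    _       = refl
count-reverse f g (suc a) reflect = begin
  toℕ (f 0) + count (f ∘′ suc) a       ≡⟨ cong₂ _+_ (cong toℕ (reflect 0 a refl))
                                            (count-reverse (f ∘′ suc) g a λ b d e → reflect (suc b) d (cong suc e)) ⟩
  toℕ (g (suc a)) + count (g ∘′ suc) a ≡⟨ +-comm (toℕ (g (suc a))) _ ⟩
  count (g ∘′ suc) a + toℕ (g (suc a)) ≡⟨ count-suc (g ∘′ suc) a ⟨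
  count (g ∘′ suc) (suc a)             ∎
  where open ≡-Reasoning

count-complement : ∀ f n → count f n + count (not ∘′ f) n ≡ n
count-complement f zero    = refl
count-complement f (suc n) with f 0
... | true  = cong suc (count-complement (f ∘′ suc) n)
... | false = trans (+-suc (count (f ∘′ suc) n) _) (cong suc (count-complement (f ∘′ suc) n))

count-window : ∀ f g h a A →
  (∀ b d → b + suc d ≡ a → f b ≡ g (suc d)) → f a ≡ false → (∀ d → f (a + suc d) ≡ h (suc d)) →
  count f (a + suc A) ≡ count (g ∘′ suc) a + count (h ∘′ suc) A
count-window f g h a A left centre right = begin
  count f (a + suc A)                                          ≡⟨ count-+ f a (suc A) ⟩
  count f a + (toℕ (f (a + 0)) + count (λ d → f (a + suc d)) A)  ≡⟨ cong₂ _+_ (count-reverse f g a left)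
                                                                    (cong₂ _+_ (cong toℕ f[a]≡false) (count-cong right A)) ⟩
  count (g ∘′ suc) a + count (h ∘′ suc) A                         ∎
  where
  open ≡-Reasoning
  f[a]≡false : f (a + 0) ≡ false
  f[a]≡false = trans (cong f (+-identityʳ a)) centre

length-filter-applyUpTo : ∀ {ℓ} {P : Pred ℕ ℓ} (P? : Decidable P) g n →
  length (filter P? (applyUpTo g n)) ≡ count (λ k → does (P? (g k))) n
length-filter-applyUpTo P? g zero = refl
length-filter-applyUpTo P? g (suc n) with does (P? (g 0))
... | true  = cong suc (length-filter-applyUpTo P? (g ∘′ suc) n)
... | false = length-filter-applyUpTo P? (g ∘′ suc) n

windowCount : (ℕ → Bool) → ℕ → ℕ → ℕ
windowCount f X Y = count (f ∘′ suc) X + count (not ∘′ f ∘′ suc) Y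

windowCount-slide : ∀ f X Y →
  windowCount f (suc X) Y + toℕ (not (f (suc Y))) ≡ windowCount f X (suc Y) + toℕ (f (suc X))
windowCount-slide f X Y = begin
  count (f ∘′ suc) (suc X) + Q + b      ≡⟨ cong (λ c → c + Q + b) (count-suc (f ∘′ suc) X) ⟩
  P + a + Q + b                         ≡⟨ rearrange P a Q b ⟩
  P + (Q + b) + a                       ≡⟨ cong (λ c → P + c + a) (count-suc (not ∘′ f ∘′ suc) Y) ⟨
  windowCount f X (suc Y) + a           ∎
  where
  open ≡-Reasoning
  P Q a b : ℕ
  P = count (f ∘′ suc) X
  Q = count (not ∘′ f ∘′ suc) Y
  a = toℕ (f (suc X))
  b = toℕ (not (f (suc Y)))
  rearrange : ∀ P a Q b → P + a + Q + b ≡ P + (Q + b) + a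
  rearrange = solve-∀

2*n≡1+m⇒n≤m : ∀ {n m} → 2 * n ≡ suc m → n ≤ m
2*n≡1+m⇒n≤m {zero}  ()
2*n≡1+m⇒n≤m {suc n} e =
  ≤-trans (m≤m+n (suc n) (n + 0)) (≤-reflexive (trans (sym (+-suc n (n + 0))) (suc-injective e)))

module AntisymmetricAbout (f : ℕ → Bool) (h : ℕ)
         (reflect : ∀ k k' → k + k' ≡ 2 * h → k ≢ h → f k' ≡ not (f k))
         (peak : f h ≡ true)
         where

  windowCount-slide-off-peak : ∀ {X Y} → suc X + suc Y ≡ 2 * h → suc Y ≢ h →
    windowCount f (suc X) Y ≡ windowCount f X (suc Y)
  windowCount-slide-off-peak {X} {Y} sum off-peak = +-cancelʳ-≡ _ _ _ (begin
    windowCount f (suc X) Y + toℕ (not (f (suc Y))) ≡⟨ windowCount-slide f X Y ⟩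
    windowCount f X (suc Y) + toℕ (f (suc X))       ≡⟨ cong (λ c → windowCount f X (suc Y) + toℕ c) mirror ⟩
    windowCount f X (suc Y) + toℕ (not (f (suc Y))) ∎)
    where
    open ≡-Reasoning
    mirror : f (suc X) ≡ not (f (suc Y))
    mirror = reflect (suc Y) (suc X) (trans (+-comm (suc Y) (suc X)) sum) off-peak

  windowCount-slide-at-peak : ∀ {X Y} → suc X + suc Y ≡ 2 * h → suc Y ≡ h →
    windowCount f (suc X) Y ≡ suc (windowCount f X (suc Y))
  windowCount-slide-at-peak {X} {Y} sum at-peak = begin
    windowCount f (suc X) Y                         ≡⟨ +-identityʳ _ ⟨
    windowCount f (suc X) Y + toℕ (not true)        ≡⟨ cong (λ c → windowCount f (suc X) Y + toℕ (not c)) fY ⟨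
    windowCount f (suc X) Y + toℕ (not (f (suc Y))) ≡⟨ windowCount-slide f X Y ⟩
    windowCount f X (suc Y) + toℕ (f (suc X))       ≡⟨ cong (λ c → windowCount f X (suc Y) + toℕ c) fX ⟩
    windowCount f X (suc Y) + 1                     ≡⟨ +-comm _ 1 ⟩
    suc (windowCount f X (suc Y))                   ∎
    where
    open ≡-Reasoning
    X-at-peak : suc X ≡ h
    X-at-peak = +-cancelʳ-≡ (suc Y) (suc X) h
      (trans sum (cong (λ c → h + c) (trans (+-identityʳ h) (sym at-peak))))
    fX : f (suc X) ≡ true
    fX = trans (cong f X-at-peak) peak
    fY : f (suc Y) ≡ true
    fY = trans (cong f at-peak) peak

  windowCount-constant : ∀ Y X → X + suc Y ≡ 2 * h → Y < h → windowCount f X Y ≡ windowCount f (X + Y) 0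
  windowCount-constant zero    X _   _    = cong (λ c → windowCount f c 0) (sym (+-identityʳ X))
  windowCount-constant (suc Y) X sum sY<h = begin
    windowCount f X (suc Y)     ≡⟨ windowCount-slide-off-peak sum′ (<⇒≢ sY<h) ⟨
    windowCount f (suc X) Y     ≡⟨ windowCount-constant Y (suc X) sum′ (<-trans (n<1+n Y) sY<h) ⟩
    windowCount f (suc X + Y) 0 ≡⟨ cong (λ c → windowCount f c 0) (+-suc X Y) ⟨
    windowCount f (X + suc Y) 0 ∎
    where
    open ≡-Reasoning
    sum′ : suc X + suc Y ≡ 2 * h
    sum′ = trans (sym (+-suc X (suc Y))) sum

  windowCount-drop : ∀ Y X → X + suc Y ≡ 2 * h → h ≤ Y → suc (windowCount f X Y) ≡ windowCount f (X + Y) 0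
  windowCount-drop zero X sum h≤0 =
    contradiction (trans (sym (+-suc X 0)) (trans sum (cong (2 *_) (n≤0⇒n≡0 h≤0)))) λ ()
  windowCount-drop (suc Y) X sum h≤sY with sum′ ← trans (sym (+-suc X (suc Y))) sum | suc Y ℕ.≟ h
  ... | yes at-peak = begin
    suc (windowCount f X (suc Y)) ≡⟨ windowCount-slide-at-peak sum′ at-peak ⟨
    windowCount f (suc X) Y       ≡⟨ windowCount-constant Y (suc X) sum′ (≤-reflexive at-peak) ⟩
    windowCount f (suc X + Y) 0   ≡⟨ cong (λ c → windowCount f c 0) (+-suc X Y) ⟨
    windowCount f (X + suc Y) 0   ∎
    where open ≡-Reasoning
  ... | no off-peak = begin
    suc (windowCount f X (suc Y)) ≡⟨ cong suc (windowCount-slide-off-peak sum′ off-peak) ⟨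
    suc (windowCount f (suc X) Y) ≡⟨ windowCount-drop Y (suc X) sum′ (≤-pred (≤∧≢⇒< h≤sY (off-peak ∘′ sym))) ⟩
    windowCount f (suc X + Y) 0   ≡⟨ cong (λ c → windowCount f c 0) (+-suc X Y) ⟨
    windowCount f (X + suc Y) 0   ∎
    where open ≡-Reasoning

  windowCount-total : ∀ T → suc T ≡ 2 * h → windowCount f T 0 ≡ h
  windowCount-total T sum = *-cancelˡ-≡ w h 2 (begin
    w + (w + 0)  ≡⟨ cong (λ c → w + c) (+-identityʳ w) ⟩
    w + w        ≡⟨ cong (λ c → w + c) drop-at-peak ⟨
    w + suc Q    ≡⟨ +-suc w Q ⟩
    suc (w + Q)  ≡⟨ cong (λ c → suc (c + Q)) (+-identityʳ P) ⟩
    suc (P + Q)  ≡⟨ cong suc (count-complement (f ∘′ suc) T) ⟩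
    suc T        ≡⟨ sum ⟩
    2 * h        ∎)
    where
    open ≡-Reasoning
    P Q w : ℕ
    P = count (f ∘′ suc) T
    Q = count (not ∘′ f ∘′ suc) T
    w = windowCount f T 0
    drop-at-peak : suc Q ≡ w
    drop-at-peak = windowCount-drop T 0 sum (2*n≡1+m⇒n≤m (sym sum))

  windowCount-below-peak : ∀ {X Y} → X + suc Y ≡ 2 * h → Y < h → windowCount f X Y ≡ h
  windowCount-below-peak {X} {Y} sum Y<h =
    trans (windowCount-constant Y X sum Y<h) (windowCount-total (X + Y) (trans (sym (+-suc X Y)) sum))

  windowCount-from-peak : ∀ {X Y} → X + suc Y ≡ 2 * h → h ≤ Y → windowCount f X Y ≡ h ∸ 1
  windowCount-from-peak {X} {Y} sum h≤Y =
    cong (_∸ 1) (trans (windowCount-drop Y X sum h≤Y) (windowCount-total (X + Y) (trans (sym (+-suc X Y)) sum)))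

odd-pos : ∀ n → odd (+ n) ≡ + oddPartℕ n
odd-pos n = ℤ.+◃n≡+n (oddPartℕ n)

odd-neg : ∀ n → odd (- + n) ≡ - + oddPartℕ n
odd-neg zero    = refl
odd-neg (suc n) = ℤ.-◃n≡-n (oddPartℕ (suc n))

dominates?-self : ∀ a → does (dominates? a a) ≡ false
dominates?-self a rewrite dec-true (a ℤ.≟ a) refl = refl

dominates?-distinct : ∀ a b → a ≢ b → does (dominates? a b) ≡ oneMod4 (odd (b - a))
dominates?-distinct a b a≢b rewrite dec-false (a ℤ.≟ b) a≢b = refl

dominates?-by-difference : ∀ a b {z} → b - a ≡ z → z ≢ 0ℤ → does (dominates? a b) ≡ oneMod4 (odd z)
dominates?-by-difference a b refl b-a≢0 = dominates?-distinct a b (b-a≢0 ∘′ ℤ.i≡j⇒i-j≡0 ∘′ sym)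

seqX-⊖ : ∀ x i d → (x + 2 * (i + d)) ℤ.⊖ (x + 2 * i) ≡ + (2 * d)
seqX-⊖ x i d = begin
  (x + 2 * (i + d)) ℤ.⊖ (x + 2 * i)    ≡⟨ cong (ℤ._⊖ (x + 2 * i)) (shift x i d) ⟩
  (x + 2 * i + 2 * d) ℤ.⊖ (x + 2 * i)  ≡⟨ ℤ.⊖-≥ (m≤m+n (x + 2 * i) (2 * d)) ⟩
  + (x + 2 * i + 2 * d ∸ (x + 2 * i))  ≡⟨ cong +_ (m+n∸m≡n (x + 2 * i) (2 * d)) ⟩
  + (2 * d)                            ∎
  where
  open ≡-Reasoning
  shift : ∀ x i d → x + 2 * (i + d) ≡ x + 2 * i + 2 * d
  shift = solve-∀

seqX-difference-forward : ∀ x i d → seqX x (suc (i + d)) - seqX x (suc i) ≡ + (2 * d)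
seqX-difference-forward x i d = trans (ℤ.[+m]-[+n]≡m⊖n (x + 2 * (i + d)) (x + 2 * i)) (seqX-⊖ x i d)

seqX-difference-backward : ∀ x i d → seqX x (suc i) - seqX x (suc (i + d)) ≡ - + (2 * d)
seqX-difference-backward x i d = begin
  + (x + 2 * i) - + (x + 2 * (i + d))    ≡⟨ ℤ.[+m]-[+n]≡m⊖n (x + 2 * i) (x + 2 * (i + d)) ⟩
  (x + 2 * i) ℤ.⊖ (x + 2 * (i + d))      ≡⟨ ℤ.⊖-swap (x + 2 * i) (x + 2 * (i + d)) ⟩
  - ((x + 2 * (i + d)) ℤ.⊖ (x + 2 * i))  ≡⟨ cong -_ (seqX-⊖ x i d) ⟩
  - + (2 * d)                            ∎
  where open ≡-Reasoning

dominates?-seqX-forward : ∀ x i d →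
  does (dominates? (seqX x (suc i)) (seqX x (suc (i + suc d)))) ≡ oddPartIsOneMod4 (suc d)
dominates?-seqX-forward x i d = begin
  does (dominates? u v)          ≡⟨ dominates?-by-difference u v (seqX-difference-forward x i (suc d)) (λ ()) ⟩
  oneMod4 (odd (+ (2 * suc d)))  ≡⟨ cong oneMod4 (odd-pos (2 * suc d)) ⟩
  oddPartIsOneMod4 (2 * suc d)   ≡⟨ oddPartIsOneMod4-double (suc d) ⟩
  oddPartIsOneMod4 (suc d)       ∎
  where
  open ≡-Reasoning
  u v : ℤ
  u = seqX x (suc i)
  v = seqX x (suc (i + suc d))

dominates?-seqX-backward : ∀ x i d →
  does (dominates? (seqX x (suc (i + suc d))) (seqX x (suc i))) ≡ not (oddPartIsOneMod4 (suc d))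
dominates?-seqX-backward x i d = begin
  does (dominates? u v)               ≡⟨ dominates?-by-difference u v (seqX-difference-backward x i (suc d)) (λ ()) ⟩
  oneMod4 (odd (- + (2 * suc d)))     ≡⟨ cong oneMod4 (odd-neg (2 * suc d)) ⟩
  oneMod4 (- + oddPartℕ (2 * suc d))  ≡⟨ cong (λ k → oneMod4 (- + k)) (oddPartℕ-double (suc d)) ⟩
  oneMod4 (- + oddPartℕ (suc d))      ≡⟨ oneMod4-neg-oddPart d ⟩
  not (oddPartIsOneMod4 (suc d))      ∎
  where
  open ≡-Reasoning
  u v : ℤ
  u = seqX x (suc (i + suc d))
  v = seqX x (suc i)

length-filter-indices : ∀ {ℓ} {P : Pred ℕ ℓ} (P? : Decidable P) N →
  length (filter P? (indices N)) ≡ count (λ k → does (P? (suc k))) N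
length-filter-indices P? N =
  trans (cong (λ js → length (filter P? js)) (map-upTo suc N)) (length-filter-applyUpTo P? suc N)

outdeg≡windowCount : ∀ x n a A → a + suc A ≡ 2 ^ n →
  outdeg x n (suc a) ≡ windowCount oddPartIsOneMod4 A a
outdeg≡windowCount x n a A size = begin
  outdeg x n (suc a)                              ≡⟨ length-filter-indices (λ j → dominates? xₐ (seqX x j)) (2 ^ n) ⟩
  count F (2 ^ n)                                 ≡⟨ cong (count F) size ⟨
  count F (a + suc A)                             ≡⟨ count-window F (not ∘′ p) p a A backward
                                                       (dominates?-self xₐ) (dominates?-seqX-forward x a) ⟩
  count (not ∘′ p ∘′ suc) a + count (p ∘′ suc) A  ≡⟨ +-comm (count (not ∘′ p ∘′ suc) a) _ ⟩
  windowCount p A a                               ∎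
  where
  open ≡-Reasoning
  p : ℕ → Bool
  p = oddPartIsOneMod4
  xₐ : ℤ
  xₐ = seqX x (suc a)
  F : ℕ → Bool
  F j = does (dominates? xₐ (seqX x (suc j)))
  backward : ∀ b d → b + suc d ≡ a → F b ≡ not (p (suc d))
  backward b d refl = dominates?-seqX-backward x b d

indeg≡windowCount : ∀ x n a A → a + suc A ≡ 2 ^ n →
  indeg x n (suc a) ≡ windowCount oddPartIsOneMod4 a A
indeg≡windowCount x n a A size = begin
  indeg x n (suc a)    ≡⟨ length-filter-indices (λ j → dominates? (seqX x j) xₐ) (2 ^ n) ⟩
  count F (2 ^ n)      ≡⟨ cong (count F) size ⟨
  count F (a + suc A)  ≡⟨ count-window F p (not ∘′ p) a A forward
                            (dominates?-self xₐ) (dominates?-seqX-backward x a) ⟩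
  windowCount p a A    ∎
  where
  open ≡-Reasoning
  p : ℕ → Bool
  p = oddPartIsOneMod4
  xₐ : ℤ
  xₐ = seqX x (suc a)
  F : ℕ → Bool
  F j = does (dominates? (seqX x (suc j)) xₐ)
  forward : ∀ b d → b + suc d ≡ a → F b ≡ p (suc d)
  forward b d refl = dominates?-seqX-forward x b d

+-suc-comm : ∀ a A → a + suc A ≡ A + suc a
+-suc-comm a A = trans (+-suc a A) (trans (cong suc (+-comm a A)) (sym (+-suc A a)))

below-half⇒above-half : ∀ {a A h} → a + suc A ≡ 2 * h → a < h → h ≤ A
below-half⇒above-half {a} {A} {h} sum a<h = ≮⇒≥ λ A<h →
  <-irrefl sum (<-≤-trans (+-mono-<-≤ a<h A<h) (≤-reflexive (cong (λ c → h + c) (sym (+-identityʳ h)))))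

above-half⇒below-half : ∀ {a A h} → a + suc A ≡ 2 * h → h ≤ a → A < h
above-half⇒below-half {a} {A} {h} sum h≤a = +-cancelˡ-≤ h (suc A) h
  (≤-trans (+-monoˡ-≤ (suc A) h≤a) (≤-reflexive (trans sum (cong (λ c → h + c) (+-identityʳ h)))))

lemma7p9 : (x n : ℕ) → 1 ≤ x → 1 ≤ n →
    ((i : ℕ) → 1 ≤ i → i ≤ 2 ^ (n ∸ 1) →
      (outdeg x n i ≡ 2 ^ (n ∸ 1)) × (indeg x n i ≡ 2 ^ (n ∸ 1) ∸ 1))
    × ((i : ℕ) → 2 ^ (n ∸ 1) + 1 ≤ i → i ≤ 2 ^ n →
      (outdeg x n i ≡ 2 ^ (n ∸ 1) ∸ 1) × (indeg x n i ≡ 2 ^ (n ∸ 1)))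
lemma7p9 x zero    _ ()
lemma7p9 x (suc m) _ _ = lower , upper
  where
  open AntisymmetricAbout oddPartIsOneMod4 (2 ^ m) (oddPartIsOneMod4-reflect m) (oddPartIsOneMod4-2^ m)
  h : ℕ
  h = 2 ^ m
  size : ∀ a → a < 2 * h → a + suc (2 * h ∸ suc a) ≡ 2 * h
  size a a<2h = trans (+-suc a _) (m+[n∸m]≡n a<2h)

  lower : (i : ℕ) → 1 ≤ i → i ≤ h → (outdeg x (suc m) i ≡ h) × (indeg x (suc m) i ≡ h ∸ 1)
  lower (suc a) _ a<h =
      trans (outdeg≡windowCount x (suc m) a A sum) (windowCount-below-peak (trans (sym (+-suc-comm a A)) sum) a<h)
    , trans (indeg≡windowCount x (suc m) a A sum) (windowCount-from-peak sum (below-half⇒above-half sum a<h))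
    where
    A : ℕ
    A = 2 * h ∸ suc a
    sum : a + suc A ≡ 2 * h
    sum = size a (≤-trans a<h (m≤m+n h _))

  upper : (i : ℕ) → h + 1 ≤ i → i ≤ 2 * h → (outdeg x (suc m) i ≡ h ∸ 1) × (indeg x (suc m) i ≡ h)
  upper zero    h+1≤0 _   = contradiction (≤-trans (m≤n+m 1 h) h+1≤0) λ ()
  upper (suc a) h+1≤i a<2h =
      trans (outdeg≡windowCount x (suc m) a A sum) (windowCount-from-peak (trans (sym (+-suc-comm a A)) sum) h≤a)
    , trans (indeg≡windowCount x (suc m) a A sum) (windowCount-below-peak sum (above-half⇒below-half sum h≤a))
    where
    A : ℕ
    A = 2 * h ∸ suc a
    sum : a + suc A ≡ 2 * h
    sum = size a a<2h
    h≤a : h ≤ a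
    h≤a = ≤-pred (subst (_≤ suc a) (+-comm h 1) h+1≤i)
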